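{- Let $r\ge2$ be an integer, let $B_r=\sum_{n\ge0}b^{(r)}_nX^n\in\mathbb{F}_2[[X]]$, $D_r=XB_r$, and let $Q_r=\sum_{n\ge0}q^{(r)}_nX^n$ be the composition inverse of $D_r$ in $\mathbb{F}_2[[X]]$. Let $(u^{(r)}_n)_{n\in\mathbb{N}}$ be the increasing sequence with $\{u^{(r)}_n\}=\{m\in\mathbb{N}: q^{(r)}_m=1\}$ and let $(m^{(r)}_n)_{n\in\mathbb{N}}$ be the increasing sequence of all natural numbers (including $0$) that are sums of distinct powers of $2^r$. Then $u^{(r)}_n=m^{(r)}_n+1$ for all $n\in\mathbb{N}$.
   Context: For an integer $r\ge2$, the sequence $(b^{(r)}_n)_{n\in\mathbb{N}}$ (values in $\mathbb{F}_2$) is defined by $b^{(r)}_0=1$ and, for $n\ge1$, $b^{(r)}_n=1$ if every maximal block of consecutive $0$'s in the binary expansion of $n$ has length divisible by $r$, and $b^{(r)}_n=0$ otherwise. The composition inverse of $U\in\mathbb{F}_2[[X]]$ with zero constant term and nonzero $X$-coefficient is the unique $V$ with $U(V(X))=V(U(X))=X$. -}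

module Defs where

open import Data.Bool using (Bool; true; false; _∧_; _xor_; if_then_else_)
open import Data.Nat using (ℕ; zero; suc; _+_; _^_; _<_; _%_; _/_; _≡ᵇ_)
open import Data.Nat.Divisibility using (_∣?_)
open import Data.List using (List; []; _∷_; map)
open import Data.Nat.ListAction using (sum)
open import Data.List.Relation.Unary.Unique.Propositional using (Unique)
open import Data.Product using (Σ; _×_; ∃)
open import Relation.Nullary using (does)
open import Relation.Binary.PropositionalEquality using (_≡_)

-- Elements of F₂ are Booleans (xor = addition, ∧ = multiplication).
-- A formal power series over F₂ is its coefficient sequence.
Series : Set
Series = ℕ → Bool

-- Binary digits of n, least significant first (fuel = n suffices).
bitsF : ℕ → ℕ → List Bool
bitsF zero    n = []
bitsF (suc f) n = if n ≡ᵇ 0 then [] else ((n % 2 ≡ᵇ 1) ∷ bitsF f (n / 2))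

bits : ℕ → List Bool
bits n = bitsF n n

-- Scan the bits, k = length of the current run of 0's; every maximal
-- block of 0's must have length divisible by r.
runsOk : ℕ → List Bool → ℕ → Bool
runsOk r []           k = does (r ∣? k)
runsOk r (true ∷ bs)  k = does (r ∣? k) ∧ runsOk r bs 0
runsOk r (false ∷ bs) k = runsOk r bs (suc k)

b : ℕ → ℕ → Bool
b r zero    = true
b r (suc n) = runsOk r (bits (suc n)) 0

B : ℕ → Series
B r = b r

D : ℕ → Series
D r zero    = false
D r (suc n) = b r n

Xs : Series
Xs n = n ≡ᵇ 1

one : Series
one n = n ≡ᵇ 0

sumTo : (ℕ → Bool) → ℕ → Bool
sumTo h zero    = h zero
sumTo h (suc n) = sumTo h n xor h (suc n)

mul : Series → Series → Series
mul f g n = sumTo (λ i → f i ∧ g (n Data.Nat.∸ i)) n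

pow : Series → ℕ → Series
pow f zero    = one
pow f (suc k) = mul f (pow f k)

-- composition U(V(X)), meaningful when V has zero constant term:
-- [X^n] U(V) = Σ_{k ≤ n} u_k [X^n] V^k
comp : Series → Series → Series
comp U V n = sumTo (λ k → U k ∧ pow V k n) n

IsCompInverse : Series → Series → Set
IsCompInverse U V = (V 0 ≡ false) × (∀ n → comp U V n ≡ Xs n) × (∀ n → comp V U n ≡ Xs n)

IsIncEnum : (ℕ → ℕ) → (ℕ → Set) → Set
IsIncEnum f P = (∀ m n → m < n → f m < f n)
              × (∀ m → (P m → ∃ λ n → f n ≡ m) × ((∃ λ n → f n ≡ m) → P m))

SumDistinctPow : ℕ → ℕ → Set
SumDistinctPow base x = Σ (List ℕ) λ es → Unique es × (sum (map (base ^_) es) ≡ x)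

module Submission where

-- Let φ r n be the number whose base-2^r digits are the binary digits of n, so that
-- φ r enumerates increasingly the sums of distinct powers of 2^r, and let M_r be the
-- characteristic series of its image.  We show that X M_r is the composition inverse
-- of D_r; its support {1 + φ r n} then gives the theorem.
--
-- Frobenius (f² = f(X²)) makes the
-- dilations f ↦ f(X^(2^j)) ring endomorphisms commuting with substitution.  Reading
-- binary digits gives B_r = 1 + X B_r(X²) + (B_r - 1)(X^(2^r)) and
-- M_r = (1 + X) M_r(X^(2^r)).  Hence F = M_r B_r(X M_r) satisfies
-- F = X F(X²) + (1 + X) F(X^(2^r)), which forces F = 1, so D_r(X M_r) = X F = X.
-- Finally right inverses are unique, the image of φ r is exactly the set of sums of
-- distinct powers of 2^r, and increasing enumerations of a set are unique.

open import Defs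
open import Data.Bool using (Bool; true; false; _∧_; _xor_; if_then_else_)
open import Data.Bool.Properties
  using (¬-not; ∧-comm; ∧-assoc; ∧-zeroʳ; ∧-idem; ∧-distribˡ-xor; ∧-distribʳ-xor;
         xor-assoc; xor-comm; xor-identityʳ; xor-same; ∧-commutativeMonoid; xor-∧-commutativeRing)
open import Data.Nat
  using (ℕ; zero; suc; _+_; _*_; _∸_; _^_; _≤_; _<_; _≤′_; ≤′-refl; ≤′-step; z≤n; s≤s; s≤s⁻¹;
         NonZero; >-nonZero; _≡ᵇ_; _%_; _/_; ⌊_/2⌋)
open import Data.Nat.Properties
open import Data.Nat.DivMod using (m/n<m; [m+kn]%n≡m%n; m*n%n≡0; m*n/n≡m; +-distrib-/-∣ʳ)
open import Data.Nat.Divisibility using (_∣?_; ∣⇒≤; ∣m+n∣m⇒∣n; ∣m∣n⇒∣m+n; ∣-refl; _∣0; n∣m*n)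
open import Data.List using (List; []; _∷_; map)
open import Data.Nat.ListAction using (sum)
import Data.List.Relation.Unary.All as All
import Data.List.Relation.Unary.All.Properties as All
open import Data.List.Relation.Unary.Unique.Propositional using (Unique)
open import Data.List.Relation.Unary.AllPairs using ([]; _∷_)
import Data.List.Relation.Unary.Unique.Propositional.Properties as Unique
open import Data.Nat.Induction using (<-rec)
open import Data.Product using (Σ; _×_; _,_; proj₁; proj₂; ∃)
open import Data.Sum using (inj₁; inj₂)
open import Data.Empty using (⊥-elim)
open import Relation.Binary.PropositionalEquality
open import Relation.Nullary using (Dec; yes; no; does; map′)
open import Relation.Nullary.Decidable using (dec-true; dec-false)
open import Algebra.Bundles using (CommutativeRing; CommutativeMonoid; CommutativeSemigroup)
open import Level using (0ℓ)
open import Function using (_∘_)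
open import Relation.Binary.Bundles using (Setoid)
open import Algebra.Properties.CommutativeSemigroup
  (CommutativeRing.+-commutativeSemigroup xor-∧-commutativeRing)
  using () renaming (interchange to xor-interchange)
open import Algebra.Properties.CommutativeSemigroup
  (CommutativeMonoid.commutativeSemigroup ∧-commutativeMonoid)
  using () renaming (interchange to ∧-interchange)
import Relation.Binary.Reasoning.Setoid as SetoidReasoning

sum-cong : ∀ {h h' : ℕ → Bool} n → (∀ i → i ≤ n → h i ≡ h' i) → sumTo h n ≡ sumTo h' n
sum-cong zero    e = e 0 z≤n
sum-cong (suc n) e = cong₂ _xor_ (sum-cong n (λ i p → e i (m≤n⇒m≤1+n p))) (e (suc n) ≤-refl)

sum-vanish : ∀ {h : ℕ → Bool} n → (∀ i → i ≤ n → h i ≡ false) → sumTo h n ≡ false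
sum-vanish zero    e = e 0 z≤n
sum-vanish (suc n) e = cong₂ _xor_ (sum-vanish n (λ i p → e i (m≤n⇒m≤1+n p))) (e (suc n) ≤-refl)

sum-xor : ∀ (h h' : ℕ → Bool) n → sumTo (λ i → h i xor h' i) n ≡ sumTo h n xor sumTo h' n
sum-xor h h' zero    = refl
sum-xor h h' (suc n) = trans (cong (_xor (h (suc n) xor h' (suc n))) (sum-xor h h' n))
  (xor-interchange (sumTo h n) (sumTo h' n) (h (suc n)) (h' (suc n)))

sum-∧ˡ : ∀ a (h : ℕ → Bool) n → sumTo (λ i → a ∧ h i) n ≡ a ∧ sumTo h n
sum-∧ˡ a h zero    = refl
sum-∧ˡ a h (suc n) = trans (cong (_xor (a ∧ h (suc n))) (sum-∧ˡ a h n))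
  (sym (∧-distribˡ-xor a (sumTo h n) (h (suc n))))

sum-∧ʳ : ∀ a (h : ℕ → Bool) n → sumTo (λ i → h i ∧ a) n ≡ sumTo h n ∧ a
sum-∧ʳ a h n = trans (sum-cong n (λ i _ → ∧-comm (h i) a))
  (trans (sum-∧ˡ a h n) (∧-comm a (sumTo h n)))

sum-swap : ∀ (h : ℕ → ℕ → Bool) n m →
  sumTo (λ i → sumTo (h i) m) n ≡ sumTo (λ j → sumTo (λ i → h i j) n) m
sum-swap h zero    m = refl
sum-swap h (suc n) m = trans (cong (_xor sumTo (h (suc n)) m) (sum-swap h n m))
  (sym (sum-xor (λ j → sumTo (λ i → h i j) n) (h (suc n)) m))

sum-pad : ∀ (h : ℕ → Bool) n N → n ≤ N → (∀ i → n < i → h i ≡ false) → sumTo h N ≡ sumTo h n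
sum-pad h n N n≤N vanish = go (≤⇒≤′ n≤N)
  where
  go : ∀ {N} → n ≤′ N → sumTo h N ≡ sumTo h n
  go ≤′-refl        = refl
  go (≤′-step n≤′N) =
    trans (cong₂ _xor_ (go n≤′N) (vanish _ (s≤s (≤′⇒≤ n≤′N)))) (xor-identityʳ _)

sum-peel : ∀ (h : ℕ → Bool) n → sumTo h (suc n) ≡ h 0 xor sumTo (λ i → h (suc i)) n
sum-peel h zero    = refl
sum-peel h (suc n) = trans (cong (_xor h (suc (suc n))) (sum-peel h n)) (xor-assoc (h 0) _ _)

sum-reverse : ∀ (h : ℕ → Bool) n → sumTo h n ≡ sumTo (λ i → h (n ∸ i)) n
sum-reverse h zero    = refl
sum-reverse h (suc n) = trans (cong (_xor h (suc n)) (sum-reverse h n))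
  (trans (xor-comm _ (h (suc n))) (sym (sum-peel (λ i → h (suc n ∸ i)) n)))

sum-single : ∀ (h : ℕ → Bool) n k → k ≤ n → (∀ i → i ≤ n → i ≢ k → h i ≡ false) →
  sumTo h n ≡ h k
sum-single h zero    zero    _ _ = refl
sum-single h (suc n) k k≤1+n others with k ≟ suc n
... | yes refl = cong (_xor h (suc n))
       (sum-vanish n (λ i i≤n → others i (m≤n⇒m≤1+n i≤n) (<⇒≢ (s≤s i≤n))))
... | no  k≢   = trans (cong₂ _xor_
         (sum-single h n k (≤-pred (≤∧≢⇒< k≤1+n k≢)) (λ i i≤n → others i (m≤n⇒m≤1+n i≤n)))
         (others (suc n) ≤-refl (λ 1+n≡k → k≢ (sym 1+n≡k))))
       (xor-identityʳ _)

sum-split-reversed : ∀ (h : ℕ → Bool) a b →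
  sumTo h (suc (a + b)) ≡ sumTo h a xor sumTo (λ j → h (suc (a + b) ∸ j)) b
sum-split-reversed h a b = trans (split b)
  (cong (sumTo h a xor_) (trans (sum-reverse _ b) (sum-cong b reindex)))
  where
  split : ∀ b → sumTo h (suc (a + b)) ≡ sumTo h a xor sumTo (λ j → h (suc (a + j))) b
  split zero    = cong (λ x → sumTo h x xor h (suc (a + 0))) (+-identityʳ a)
  split (suc b) = trans (cong (λ x → sumTo h x xor h (suc (a + suc b))) (+-suc a b))
    (trans (cong (_xor h (suc (a + suc b))) (split b)) (xor-assoc (sumTo h a) _ _))
  reindex : ∀ j → j ≤ b → h (suc (a + (b ∸ j))) ≡ h (suc (a + b) ∸ j)
  reindex j j≤b = cong h (sym (+-∸-assoc (suc a) j≤b))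

sum-triangle : ∀ (T : ℕ → ℕ → Bool) n →
  sumTo (λ a → sumTo (λ i → T i a) a) n ≡ sumTo (λ i → sumTo (λ j → T i (i + j)) (n ∸ i)) n
sum-triangle T zero    = refl
sum-triangle T (suc n) = begin
    sumTo (λ a → sumTo (λ i → T i a) a) n xor (sumTo (λ i → T i (suc n)) n xor T (suc n) (suc n))
  ≡⟨ cong (_xor (sumTo (λ i → T i (suc n)) n xor T (suc n) (suc n))) (sum-triangle T n) ⟩
    Rows n xor (sumTo (λ i → T i (suc n)) n xor T (suc n) (suc n))
  ≡⟨ sym (xor-assoc (Rows n) _ _) ⟩
    (Rows n xor sumTo (λ i → T i (suc n)) n) xor T (suc n) (suc n)
  ≡⟨ cong₂ _xor_ (trans (sym (sum-xor _ _ n)) (sum-cong n longerRow)) lastRow ⟩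
    Rows (suc n)
  ∎
  where
  open ≡-Reasoning
  Rows : ℕ → Bool
  Rows m = sumTo (λ i → sumTo (λ j → T i (i + j)) (m ∸ i)) m
  longerRow : ∀ i → i ≤ n →
    (sumTo (λ j → T i (i + j)) (n ∸ i) xor T i (suc n)) ≡ sumTo (λ j → T i (i + j)) (suc n ∸ i)
  longerRow i i≤n = trans
    (cong (λ a → sumTo (λ j → T i (i + j)) (n ∸ i) xor T i a)
          (sym (trans (+-suc i (n ∸ i)) (cong suc (m+[n∸m]≡n i≤n)))))
    (cong (sumTo (λ j → T i (i + j))) (sym (+-∸-assoc 1 i≤n)))
  lastRow : T (suc n) (suc n) ≡ sumTo (λ j → T (suc n) (suc n + j)) (n ∸ n)
  lastRow = trans (cong (T (suc n)) (sym (+-identityʳ (suc n))))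
                  (cong (sumTo (λ j → T (suc n) (suc n + j))) (sym (n∸n≡0 n)))

-- The ring F₂[[X]]: series are equal when coefficientwise equal (_≗_).

module ≗-Reasoning = SetoidReasoning (ℕ →-setoid Bool)

add : Series → Series → Series
add f g n = f n xor g n

shift : Series → Series
shift f zero    = false
shift f (suc n) = f n

add-congʳ : ∀ f {g g'} → g ≗ g' → add f g ≗ add f g'
add-congʳ f g≗g' n = cong (f n xor_) (g≗g' n)

mul-cong : ∀ {f f' g g'} → f ≗ f' → g ≗ g' → mul f g ≗ mul f' g'
mul-cong f≗f' g≗g' n = sum-cong n (λ i _ → cong₂ _∧_ (f≗f' i) (g≗g' (n ∸ i)))

mul-congˡ : ∀ {f f'} g → f ≗ f' → mul f g ≗ mul f' g
mul-congˡ g f≗f' = mul-cong {g = g} f≗f' (λ _ → refl)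

mul-congʳ : ∀ f {g g'} → g ≗ g' → mul f g ≗ mul f g'
mul-congʳ f = mul-cong {f = f} (λ _ → refl)

mul-comm : ∀ f g → mul f g ≗ mul g f
mul-comm f g n = trans (sum-reverse _ n) (sum-cong n (λ i i≤n →
  trans (cong (λ k → f (n ∸ i) ∧ g k) (m∸[m∸n]≡n i≤n)) (∧-comm (f (n ∸ i)) (g i))))

mul-distribˡ : ∀ f g h → mul f (add g h) ≗ add (mul f g) (mul f h)
mul-distribˡ f g h n =
  trans (sum-cong n (λ i _ → ∧-distribˡ-xor (f i) (g (n ∸ i)) (h (n ∸ i)))) (sum-xor _ _ n)

mul-distribʳ : ∀ f g h → mul (add g h) f ≗ add (mul g f) (mul h f)
mul-distribʳ f g h n =
  trans (sum-cong n (λ i _ → ∧-distribʳ-xor (f (n ∸ i)) (g i) (h i))) (sum-xor _ _ n)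

mul-identityˡ : ∀ g → mul one g ≗ g
mul-identityˡ g n = sum-single _ n 0 z≤n (λ { zero _ 0≢0 → ⊥-elim (0≢0 refl) ; (suc i) _ _ → refl })

mul-identityʳ : ∀ g → mul g one ≗ g
mul-identityʳ g n = trans (mul-comm g one n) (mul-identityˡ g n)

mul-X : ∀ g → mul Xs g ≗ shift g
mul-X g zero    = refl
mul-X g (suc n) = sum-single _ (suc n) 1 (s≤s z≤n)
  (λ { zero _ _ → refl ; (suc zero) _ 1≢1 → ⊥-elim (1≢1 refl) ; (suc (suc i)) _ _ → refl })

mul-1+X : ∀ g → mul (add one Xs) g ≗ add g (shift g)
mul-1+X g n = trans (mul-distribʳ g one Xs n) (cong₂ _xor_ (mul-identityˡ g n) (mul-X g n))

-- Associativity: both sides are the sum over i + j + k = n, via the triangle reindexing.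
mul-assoc : ∀ f g h → mul (mul f g) h ≗ mul f (mul g h)
mul-assoc f g h n = begin
    sumTo (λ a → sumTo (λ i → f i ∧ g (a ∸ i)) a ∧ h (n ∸ a)) n
  ≡⟨ sum-cong n (λ a _ → sym (sum-∧ʳ (h (n ∸ a)) _ a)) ⟩
    sumTo (λ a → sumTo (λ i → T i a) a) n
  ≡⟨ sum-triangle T n ⟩
    sumTo (λ i → sumTo (λ j → T i (i + j)) (n ∸ i)) n
  ≡⟨ sum-cong n (λ i _ → trans (sum-cong (n ∸ i) (λ j _ → regroup i j)) (sum-∧ˡ (f i) _ (n ∸ i))) ⟩
    sumTo (λ i → f i ∧ sumTo (λ j → g j ∧ h (n ∸ i ∸ j)) (n ∸ i)) n
  ∎
  where
  open ≡-Reasoning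
  T : ℕ → ℕ → Bool
  T i a = (f i ∧ g (a ∸ i)) ∧ h (n ∸ a)
  regroup : ∀ i j → T i (i + j) ≡ f i ∧ (g j ∧ h (n ∸ i ∸ j))
  regroup i j = trans (cong₂ (λ x y → (f i ∧ g x) ∧ h y) (m+n∸m≡n i j) (sym (∸-+-assoc n i j)))
                      (∧-assoc (f i) _ _)

-- Series form a commutative semigroup under multiplication; this gives the
-- rearrangement  (ab)(cd) = (ac)(bd)  from the library.
mul-commutativeSemigroup : CommutativeSemigroup 0ℓ 0ℓ
mul-commutativeSemigroup = record
  { Carrier = Series
  ; _≈_     = _≗_
  ; _∙_     = mul
  ; isCommutativeSemigroup = record
    { isSemigroup = record
      { isMagma = record { isEquivalence = Setoid.isEquivalence (ℕ →-setoid Bool) ; ∙-cong = mul-cong }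
      ; assoc   = mul-assoc }
    ; comm = mul-comm } }

open import Algebra.Properties.CommutativeSemigroup mul-commutativeSemigroup
  using () renaming (interchange to mul-interchange; x∙yz≈y∙xz to mul-leftComm)

-- Powers and composition.  Throughout, the inner series W has zero constant
-- term, so that W^k = O(X^k) and U(W) is well defined coefficientwise.

pow-+ : ∀ W i j → pow W (i + j) ≗ mul (pow W i) (pow W j)
pow-+ W zero    j n = sym (mul-identityˡ (pow W j) n)
pow-+ W (suc i) j n =
  trans (mul-congʳ W (pow-+ W i j) n) (sym (mul-assoc W (pow W i) (pow W j) n))

pow-vanish : ∀ W → W 0 ≡ false → ∀ k n → n < k → pow W k n ≡ false
pow-vanish W w₀ (suc k) n (s≤s n≤k) = sum-vanish n term
  where
  term : ∀ i → i ≤ n → (W i ∧ pow W k (n ∸ i)) ≡ false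
  term zero    _ = cong (_∧ pow W k n) w₀
  term (suc i) 1+i≤n = trans (cong (W (suc i) ∧_) (pow-vanish W w₀ k (n ∸ suc i) n-1-i<k)) (∧-zeroʳ _)
    where
    n-1-i<k : n ∸ suc i < k
    n-1-i<k = <-≤-trans (∸-monoʳ-< (s≤s z≤n) 1+i≤n) n≤k

comp-pad : ∀ U W → W 0 ≡ false → ∀ n N → n ≤ N →
  comp U W n ≡ sumTo (λ k → U k ∧ pow W k n) N
comp-pad U W w₀ n N n≤N = sym (sum-pad _ n N n≤N
  (λ k n<k → trans (cong (U k ∧_) (pow-vanish W w₀ k n n<k)) (∧-zeroʳ _)))

comp-congˡ : ∀ {U U'} W → U ≗ U' → comp U W ≗ comp U' W
comp-congˡ W U≗U' n = sum-cong n (λ k _ → cong (_∧ pow W k n) (U≗U' k))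

comp-add : ∀ U V W → comp (add U V) W ≗ add (comp U W) (comp V W)
comp-add U V W n =
  trans (sum-cong n (λ k _ → ∧-distribʳ-xor (pow W k n) (U k) (V k))) (sum-xor _ _ n)

comp-one : ∀ W → comp one W ≗ one
comp-one W n = sum-single _ n 0 z≤n (λ { zero _ 0≢0 → ⊥-elim (0≢0 refl) ; (suc k) _ _ → refl })

comp-X : ∀ W → W 0 ≡ false → comp Xs W ≗ W
comp-X W w₀ zero    = sym w₀
comp-X W w₀ (suc n) = trans
  (sum-single _ (suc n) 1 (s≤s z≤n)
    (λ { zero _ _ → refl ; (suc zero) _ 1≢1 → ⊥-elim (1≢1 refl) ; (suc (suc k)) _ _ → refl }))
  (mul-identityʳ W (suc n))

comp-mul : ∀ U V W → W 0 ≡ false → comp (mul U V) W ≗ mul (comp U W) (comp V W)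
comp-mul U V W w₀ n = begin
    sumTo (λ k → sumTo (λ i → U i ∧ V (k ∸ i)) k ∧ P k n) n
  ≡⟨ sum-cong n (λ k _ → sym (sum-∧ʳ (P k n) _ k)) ⟩
    sumTo (λ k → sumTo (λ i → T i k) k) n
  ≡⟨ sum-triangle T n ⟩
    sumTo (λ i → sumTo (λ j → T i (i + j)) (n ∸ i)) n
  ≡⟨ sum-cong n pairTerms ⟩
    sumTo (λ i → sumTo (λ j → sumTo (λ a → R a i j) n) n) n
  ≡⟨ sum-cong n (λ i _ → sum-swap (λ j a → R a i j) n n) ⟩
    sumTo (λ i → sumTo (λ a → sumTo (λ j → R a i j) n) n) n
  ≡⟨ sum-swap (λ i a → sumTo (λ j → R a i j) n) n n ⟩
    sumTo (λ a → sumTo (λ i → sumTo (λ j → R a i j) n) n) n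
  ≡⟨ sum-cong n factor ⟩
    sumTo (λ a → comp U W a ∧ comp V W (n ∸ a)) n
  ∎
  where
  open ≡-Reasoning
  P : ℕ → Series
  P = pow W
  T : ℕ → ℕ → Bool
  T i k = (U i ∧ V (k ∸ i)) ∧ P k n
  R : ℕ → ℕ → ℕ → Bool
  R a i j = (U i ∧ P i a) ∧ (V j ∧ P j (n ∸ a))
  pairTerms : ∀ i → i ≤ n →
    sumTo (λ j → T i (i + j)) (n ∸ i) ≡ sumTo (λ j → sumTo (λ a → R a i j) n) n
  pairTerms i i≤n = trans (sym (sum-pad _ (n ∸ i) n (m∸n≤m n i) beyond)) (sum-cong n (λ j _ → expand j))
    where
    beyond : ∀ j → n ∸ i < j → T i (i + j) ≡ false
    beyond j n∸i<j = trans (cong ((U i ∧ V (i + j ∸ i)) ∧_) (pow-vanish W w₀ (i + j) n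
      (subst (_< i + j) (m+[n∸m]≡n i≤n) (+-monoʳ-< i n∸i<j)))) (∧-zeroʳ _)
    expand : ∀ j → T i (i + j) ≡ sumTo (λ a → R a i j) n
    expand j = begin
        (U i ∧ V (i + j ∸ i)) ∧ P (i + j) n
      ≡⟨ cong₂ (λ x y → (U i ∧ V x) ∧ y) (m+n∸m≡n i j) (pow-+ W i j n) ⟩
        (U i ∧ V j) ∧ mul (P i) (P j) n
      ≡⟨ sym (sum-∧ˡ (U i ∧ V j) _ n) ⟩
        sumTo (λ a → (U i ∧ V j) ∧ (P i a ∧ P j (n ∸ a))) n
      ≡⟨ sum-cong n (λ a _ → ∧-interchange (U i) (V j) (P i a) (P j (n ∸ a))) ⟩
        sumTo (λ a → R a i j) n
      ∎
  factor : ∀ a → a ≤ n → sumTo (λ i → sumTo (λ j → R a i j) n) n ≡ comp U W a ∧ comp V W (n ∸ a)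
  factor a a≤n = begin
      sumTo (λ i → sumTo (λ j → R a i j) n) n
    ≡⟨ sum-cong n (λ i _ → sum-∧ˡ (U i ∧ P i a) _ n) ⟩
      sumTo (λ i → (U i ∧ P i a) ∧ sumTo (λ j → V j ∧ P j (n ∸ a)) n) n
    ≡⟨ sum-∧ʳ _ _ n ⟩
      sumTo (λ i → U i ∧ P i a) n ∧ sumTo (λ j → V j ∧ P j (n ∸ a)) n
    ≡⟨ sym (cong₂ _∧_ (comp-pad U W w₀ a n a≤n) (comp-pad V W w₀ (n ∸ a) n (m∸n≤m n a))) ⟩
      comp U W a ∧ comp V W (n ∸ a)
    ∎

isEven : ℕ → Bool
isEven zero          = true
isEven (suc zero)    = false
isEven (suc (suc n)) = isEven n

data Halves : ℕ → Set where
  twice   : ∀ m → Halves (m + m)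
  twice+1 : ∀ m → Halves (suc (m + m))

halves : ∀ n → Halves n
halves zero          = twice 0
halves (suc zero)    = twice+1 0
halves (suc (suc n)) with halves n
... | twice m   = subst Halves (cong suc (+-suc m m)) (twice (suc m))
... | twice+1 m = subst Halves (cong (suc ∘ suc) (+-suc m m)) (twice+1 (suc m))

isEven-twice : ∀ m → isEven (m + m) ≡ true
isEven-twice zero    = refl
isEven-twice (suc m) = trans (cong (isEven ∘ suc) (+-suc m m)) (isEven-twice m)

isEven-twice+1 : ∀ m → isEven (suc (m + m)) ≡ false
isEven-twice+1 zero    = refl
isEven-twice+1 (suc m) = trans (cong (isEven ∘ suc ∘ suc) (+-suc m m)) (isEven-twice+1 m)

dilate : Series → Series
dilate f n = if isEven n then f ⌊ n /2⌋ else false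

dilate-twice : ∀ f m → dilate f (m + m) ≡ f m
dilate-twice f m = trans (cong (λ e → if e then f ⌊ m + m /2⌋ else false) (isEven-twice m))
                         (cong f (sym (n≡⌊n+n/2⌋ m)))

dilate-twice+1 : ∀ f m → dilate f (suc (m + m)) ≡ false
dilate-twice+1 f m = cong (if_then f ⌊ suc (m + m) /2⌋ else false) (isEven-twice+1 m)

dilate-cong : ∀ {f g} → f ≗ g → dilate f ≗ dilate g
dilate-cong f≗g n = cong (if isEven n then_else false) (f≗g ⌊ n /2⌋)

dilate-add : ∀ f g → dilate (add f g) ≗ add (dilate f) (dilate g)
dilate-add f g n with isEven n
... | true  = refl
... | false = refl

dilate-one : dilate one ≗ one
dilate-one n with halves n
... | twice zero    = refl
... | twice (suc m) = dilate-twice one (suc m)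
... | twice+1 m     = dilate-twice+1 one m

-- In characteristic 2 the terms of a palindromic sum cancel in pairs, except
-- for the middle term when there is one.
Palindromic : (ℕ → Bool) → ℕ → Set
Palindromic h n = ∀ i → i ≤ n → h (n ∸ i) ≡ h i

sum-palindromic-odd : ∀ h m → Palindromic h (suc (m + m)) → sumTo h (suc (m + m)) ≡ false
sum-palindromic-odd h m pal = trans (sum-split-reversed h m m) (trans
  (cong (sumTo h m xor_) (sum-cong m (λ j j≤m → pal j (≤-trans j≤m (≤-trans (m≤n+m m m) (n≤1+n _))))))
  (xor-same (sumTo h m)))

sum-palindromic-even : ∀ h m → Palindromic h (m + m) → sumTo h (m + m) ≡ h m
sum-palindromic-even h zero    pal = refl
sum-palindromic-even h (suc k) pal = begin
    sumTo h (suc (k + suc k))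
  ≡⟨ sum-split-reversed h k (suc k) ⟩
    sumTo h k xor sumTo (λ j → h (suc (k + suc k) ∸ j)) (suc k)
  ≡⟨ cong (sumTo h k xor_) (sum-cong (suc k) (λ j j≤ → pal j (≤-trans j≤ (m≤n+m (suc k) (suc k))))) ⟩
    sumTo h k xor (sumTo h k xor h (suc k))
  ≡⟨ sym (xor-assoc (sumTo h k) (sumTo h k) (h (suc k))) ⟩
    (sumTo h k xor sumTo h k) xor h (suc k)
  ≡⟨ cong (_xor h (suc k)) (xor-same (sumTo h k)) ⟩
    h (suc k)
  ∎
  where open ≡-Reasoning

square-palindromic : ∀ (f : Series) n → Palindromic (λ i → f i ∧ f (n ∸ i)) n
square-palindromic f n i i≤n =
  trans (cong (λ k → f (n ∸ i) ∧ f k) (m∸[m∸n]≡n i≤n)) (∧-comm (f (n ∸ i)) (f i))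

frobenius : ∀ f → mul f f ≗ dilate f
frobenius f n with halves n
... | twice m   =
  trans (sum-palindromic-even (λ i → f i ∧ f (m + m ∸ i)) m (square-palindromic f (m + m)))
  (trans (cong (λ k → f m ∧ f k) (m+n∸m≡n m m)) (trans (∧-idem (f m)) (sym (dilate-twice f m))))
... | twice+1 m =
  trans (sum-palindromic-odd (λ i → f i ∧ f (suc (m + m) ∸ i)) m (square-palindromic f (suc (m + m))))
        (sym (dilate-twice+1 f m))

dilate-mul : ∀ f g → mul (dilate f) (dilate g) ≗ dilate (mul f g)
dilate-mul f g = begin
    mul (dilate f) (dilate g)
  ≈⟨ mul-cong (frobenius f) (frobenius g) ⟨
    mul (mul f f) (mul g g)
  ≈⟨ mul-interchange f f g g ⟩
    mul (mul f g) (mul f g)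
  ≈⟨ frobenius (mul f g) ⟩
    dilate (mul f g)
  ∎
  where open ≗-Reasoning

comp-dilate : ∀ U W → W 0 ≡ false → comp (dilate U) W ≗ dilate (comp U W)
comp-dilate U W w₀ = begin
    comp (dilate U) W
  ≈⟨ comp-congˡ W (frobenius U) ⟨
    comp (mul U U) W
  ≈⟨ comp-mul U U W w₀ ⟩
    mul (comp U W) (comp U W)
  ≈⟨ frobenius (comp U W) ⟩
    dilate (comp U W)
  ∎
  where open ≗-Reasoning

dilateⁿ : ℕ → Series → Series
dilateⁿ zero    f = f
dilateⁿ (suc j) f = dilate (dilateⁿ j f)

dilateⁿ-cong : ∀ j {f g} → f ≗ g → dilateⁿ j f ≗ dilateⁿ j g
dilateⁿ-cong zero    f≗g = f≗g
dilateⁿ-cong (suc j) f≗g = dilate-cong (dilateⁿ-cong j f≗g)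

dilateⁿ-add : ∀ j f g → dilateⁿ j (add f g) ≗ add (dilateⁿ j f) (dilateⁿ j g)
dilateⁿ-add zero    f g n = refl
dilateⁿ-add (suc j) f g n =
  trans (dilate-cong (dilateⁿ-add j f g) n) (dilate-add (dilateⁿ j f) (dilateⁿ j g) n)

dilateⁿ-one : ∀ j → dilateⁿ j one ≗ one
dilateⁿ-one zero    n = refl
dilateⁿ-one (suc j) n = trans (dilate-cong (dilateⁿ-one j) n) (dilate-one n)

dilateⁿ-mul : ∀ j f g → mul (dilateⁿ j f) (dilateⁿ j g) ≗ dilateⁿ j (mul f g)
dilateⁿ-mul zero    f g n = refl
dilateⁿ-mul (suc j) f g n =
  trans (dilate-mul (dilateⁿ j f) (dilateⁿ j g) n) (dilate-cong (dilateⁿ-mul j f g) n)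

comp-dilateⁿ : ∀ j U W → W 0 ≡ false → comp (dilateⁿ j U) W ≗ dilateⁿ j (comp U W)
comp-dilateⁿ zero    U W w₀ n = refl
comp-dilateⁿ (suc j) U W w₀ n =
  trans (comp-dilate (dilateⁿ j U) W w₀ n) (dilate-cong (comp-dilateⁿ j U W w₀) n)

2^suc-* : ∀ j y → 2 ^ suc j * y ≡ 2 ^ j * y + 2 ^ j * y
2^suc-* j y = trans (*-assoc 2 (2 ^ j) y) (cong (2 ^ j * y +_) (+-identityʳ (2 ^ j * y)))

dilateⁿ-at : ∀ j f y → dilateⁿ j f (2 ^ j * y) ≡ f y
dilateⁿ-at zero    f y = cong f (+-identityʳ y)
dilateⁿ-at (suc j) f y = trans (cong (dilateⁿ (suc j) f) (2^suc-* j y))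
  (trans (dilate-twice (dilateⁿ j f) (2 ^ j * y)) (dilateⁿ-at j f y))

dilateⁿ-support : ∀ j f n → dilateⁿ j f n ≡ true → ∃ λ y → n ≡ 2 ^ j * y × f y ≡ true
dilateⁿ-support zero    f n fn = n , sym (+-identityʳ n) , fn
dilateⁿ-support (suc j) f n fn with halves n
... | twice m with dilateⁿ-support j f m (trans (sym (dilate-twice (dilateⁿ j f) m)) fn)
...   | y , m≡2^jy , fy = y , trans (cong₂ _+_ m≡2^jy m≡2^jy) (sym (2^suc-* j y)) , fy
dilateⁿ-support (suc j) f n fn | twice+1 m with () ← trans (sym (dilate-twice+1 (dilateⁿ j f) m)) fn

-- Coefficients of f(X²) up to n+1 only involve coefficients of f up to n;
-- this causality drives the coefficientwise inductions below.
AgreeUpTo : ℕ → Series → Series → Set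
AgreeUpTo n f g = ∀ i → i ≤ n → f i ≡ g i

dilate-agree : ∀ {f g} n → AgreeUpTo n f g → AgreeUpTo (suc n) (dilate f) (dilate g)
dilate-agree n agree i i≤1+n = cong (if isEven i then_else false)
  (agree ⌊ i /2⌋ (≤-trans (⌊n/2⌋-mono i≤1+n) (s≤s⁻¹ (⌊n/2⌋<n n))))

dilateⁿ-agree : ∀ j {f g} n → AgreeUpTo n f g → AgreeUpTo n (dilateⁿ j f) (dilateⁿ j g)
dilateⁿ-agree zero    n agree = agree
dilateⁿ-agree (suc j) n agree i i≤n = dilate-agree n (dilateⁿ-agree j n agree) i (m≤n⇒m≤1+n i≤n)

dilateⁿ-agree-suc : ∀ j .{{_ : NonZero j}} {f g} n → AgreeUpTo n f g →
  dilateⁿ j f (suc n) ≡ dilateⁿ j g (suc n)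
dilateⁿ-agree-suc (suc j) n agree = dilate-agree n (dilateⁿ-agree j n agree) (suc n) ≤-refl

⌊1+n/2⌋≤n : ∀ n → suc n / 2 ≤ n
⌊1+n/2⌋≤n n = s≤s⁻¹ (m/n<m (suc n) 2 (s≤s (s≤s z≤n)))

bitsF-fuel : ∀ f g n → n ≤ f → n ≤ g → bitsF f n ≡ bitsF g n
bitsF-fuel zero    zero    zero    _ _ = refl
bitsF-fuel zero    (suc g) zero    _ _ = refl
bitsF-fuel (suc f) zero    zero    _ _ = refl
bitsF-fuel (suc f) (suc g) zero    _ _ = refl
bitsF-fuel (suc f) (suc g) (suc n) (s≤s n≤f) (s≤s n≤g) =
  cong ((suc n % 2 ≡ᵇ 1) ∷_)
       (bitsF-fuel f g (suc n / 2) (≤-trans (⌊1+n/2⌋≤n n) n≤f) (≤-trans (⌊1+n/2⌋≤n n) n≤g))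

bits-suc : ∀ n → bits (suc n) ≡ (suc n % 2 ≡ᵇ 1) ∷ bits (suc n / 2)
bits-suc n = cong ((suc n % 2 ≡ᵇ 1) ∷_) (bitsF-fuel n (suc n / 2) (suc n / 2) (⌊1+n/2⌋≤n n) ≤-refl)

m*2≡m+m : ∀ m → m * 2 ≡ m + m
m*2≡m+m m = trans (*-comm m 2) (cong (m +_) (+-identityʳ m))

bits-twice+1 : ∀ m → bits (suc (m + m)) ≡ true ∷ bits m
bits-twice+1 m = trans (bits-suc (m + m)) (cong₂ (λ d q → (d ≡ᵇ 1) ∷ bits q) remainder quotient)
  where
  remainder : suc (m + m) % 2 ≡ 1
  remainder = trans (cong (_% 2) (cong suc (sym (m*2≡m+m m)))) ([m+kn]%n≡m%n 1 m 2)
  quotient : suc (m + m) / 2 ≡ m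
  quotient = trans (cong (_/ 2) (cong suc (sym (m*2≡m+m m))))
                   (trans (+-distrib-/-∣ʳ 1 {d = 2} (n∣m*n m)) (m*n/n≡m m 2))

bits-twice : ∀ m → bits (suc m + suc m) ≡ false ∷ bits (suc m)
bits-twice m = trans (bits-suc (m + suc m)) (cong₂ (λ d q → (d ≡ᵇ 1) ∷ bits q) remainder quotient)
  where
  remainder : (suc m + suc m) % 2 ≡ 0
  remainder = trans (cong (_% 2) (sym (m*2≡m+m (suc m)))) (m*n%n≡0 (suc m) 2)
  quotient : (suc m + suc m) / 2 ≡ suc m
  quotient = trans (cong (_/ 2) (sym (m*2≡m+m (suc m)))) (m*n/n≡m (suc m) 2)

-- The functional equation of B_r.

does-cong : ∀ {P Q : Set} (p : Dec P) (q : Dec Q) → (P → Q) → (Q → P) → does p ≡ does q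
does-cong (yes _) (yes _) _   _   = refl
does-cong (yes p) (no ¬q) p→q _   = ⊥-elim (¬q (p→q p))
does-cong (no ¬p) (yes q) _   q→p = ⊥-elim (¬p (q→p q))
does-cong (no _)  (no _)  _   _   = refl

runsOk-cycle : ∀ r bs k → runsOk r bs (r + k) ≡ runsOk r bs k
runsOk-cycle r []           k =
  does-cong (r ∣? (r + k)) (r ∣? k) (λ r∣r+k → ∣m+n∣m⇒∣n r∣r+k ∣-refl) (∣m∣n⇒∣m+n ∣-refl)
runsOk-cycle r (true ∷ bs)  k = cong (_∧ runsOk r bs 0) (runsOk-cycle r [] k)
runsOk-cycle r (false ∷ bs) k = trans (cong (runsOk r bs) (sym (+-suc r k))) (runsOk-cycle r bs (suc k))

runsOk-bits : ∀ r m → runsOk r (bits m) 0 ≡ b r m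
runsOk-bits r zero    = does-cong (r ∣? 0) (yes (r ∣0)) (λ _ → r ∣0) (λ r∣0 → r∣0)
runsOk-bits r (suc m) = refl

B⁺ : ℕ → Series
B⁺ r = add (B r) one

-- Reading the digits of n ≥ 1 after a pending block of r - j zeros (0 ≤ j < r)
-- accepts exactly when n = 2^j y with b^{(r)}_y = 1, y ≥ 1.
runsOk-pending : ∀ r j → j < r → ∀ n → 0 < n → runsOk r (bits n) (r ∸ j) ≡ dilateⁿ j (B⁺ r) n
runsOk-pending r zero    _ (suc n) _ = trans
  (cong (runsOk r (bits (suc n))) (sym (+-identityʳ r)))
  (trans (runsOk-cycle r (bits (suc n)) 0) (sym (xor-identityʳ _)))
runsOk-pending r (suc j) 1+j<r n 0<n with halves n
... | twice (suc m) = begin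
    runsOk r (bits (suc m + suc m)) (r ∸ suc j)
  ≡⟨ cong (λ ds → runsOk r ds (r ∸ suc j)) (bits-twice m) ⟩
    runsOk r (bits (suc m)) (suc (r ∸ suc j))
  ≡⟨ cong (runsOk r (bits (suc m))) (sym (+-∸-assoc 1 (<⇒≤ 1+j<r))) ⟩
    runsOk r (bits (suc m)) (r ∸ j)
  ≡⟨ runsOk-pending r j (<-trans (n<1+n j) 1+j<r) (suc m) (s≤s z≤n) ⟩
    dilateⁿ j (B⁺ r) (suc m)
  ≡⟨ sym (dilate-twice (dilateⁿ j (B⁺ r)) (suc m)) ⟩
    dilateⁿ (suc j) (B⁺ r) (suc m + suc m)
  ∎
  where open ≡-Reasoning
... | twice+1 m = trans (cong (λ ds → runsOk r ds (r ∸ suc j)) (bits-twice+1 m))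
  (trans (cong (_∧ runsOk r (bits m) 0) blockTooShort) (sym (dilate-twice+1 (dilateⁿ j (B⁺ r)) m)))
  where
  -- the lowest digit is 1 and ends a block of length r - (j+1), strictly between 0 and r
  blockTooShort : does (r ∣? (r ∸ suc j)) ≡ false
  blockTooShort with r ∣? (r ∸ suc j)
  ... | yes r∣ = ⊥-elim (<⇒≱ (∸-monoʳ-< (s≤s z≤n) (<⇒≤ 1+j<r))
                          (∣⇒≤ {{>-nonZero (m<n⇒0<n∸m 1+j<r)}} r∣))
  ... | no  _  = refl

-- B_r = 1 + X B_r(X²) + (B_r - 1)(X^(2^r)): an odd n ends with the digit 1, and an
-- even n > 0 with a block of zeros whose length must be a positive multiple of r.
B-equation : ∀ r .{{_ : NonZero r}} →
  B r ≗ add one (add (shift (dilate (B r))) (dilateⁿ r (B⁺ r)))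
B-equation r@(suc r') n with halves n
... | twice zero = cong (λ c → true xor (false xor c)) (sym constantTerm)
  where
  constantTerm : dilateⁿ r (B⁺ r) 0 ≡ false
  constantTerm = trans (cong (dilateⁿ r (B⁺ r)) (sym (*-zeroʳ (2 ^ r)))) (dilateⁿ-at r (B⁺ r) 0)
... | twice (suc m) = begin
    runsOk r (bits (suc m + suc m)) 0
  ≡⟨ cong (λ ds → runsOk r ds 0) (bits-twice m) ⟩
    runsOk r (bits (suc m)) 1
  ≡⟨ cong (runsOk r (bits (suc m))) (sym (m+n∸n≡m 1 r')) ⟩
    runsOk r (bits (suc m)) (suc r' ∸ r')
  ≡⟨ runsOk-pending r r' ≤-refl (suc m) (s≤s z≤n) ⟩
    dilateⁿ r' (B⁺ r) (suc m)
  ≡⟨ sym (dilate-twice (dilateⁿ r' (B⁺ r)) (suc m)) ⟩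
    dilateⁿ r (B⁺ r) (suc m + suc m)
  ≡⟨ cong (_xor dilateⁿ r (B⁺ r) (suc m + suc m))
          (sym (trans (cong (dilate (B r)) (+-suc m m)) (dilate-twice+1 (B r) m))) ⟩
    add one (add (shift (dilate (B r))) (dilateⁿ r (B⁺ r))) (suc m + suc m)
  ∎
  where open ≡-Reasoning
... | twice+1 m = begin
    runsOk r (bits (suc (m + m))) 0
  ≡⟨ cong (λ ds → runsOk r ds 0) (bits-twice+1 m) ⟩
    does (r ∣? 0) ∧ runsOk r (bits m) 0
  ≡⟨ cong₂ _∧_ (runsOk-bits r 0) (runsOk-bits r m) ⟩
    b r m
  ≡⟨ sym (dilate-twice (B r) m) ⟩
    dilate (B r) (m + m)
  ≡⟨ sym (xor-identityʳ _) ⟩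
    dilate (B r) (m + m) xor false
  ≡⟨ cong (dilate (B r) (m + m) xor_) (sym (dilate-twice+1 (dilateⁿ r' (B⁺ r)) m)) ⟩
    add one (add (shift (dilate (B r))) (dilateⁿ r (B⁺ r))) (suc (m + m))
  ∎
  where open ≡-Reasoning

-- Sums of distinct powers of 2^r.  Reading the binary digits of n in base 2^r
-- gives the n-th such sum, φ r n.

digitValue : ℕ → List Bool → ℕ
digitValue k []       = 0
digitValue k (d ∷ ds) = (if d then 1 else 0) + k * digitValue k ds

φ : ℕ → ℕ → ℕ
φ r n = digitValue (2 ^ r) (bits n)

φ-twice : ∀ r m → φ r (m + m) ≡ 2 ^ r * φ r m
φ-twice r zero    = sym (*-zeroʳ (2 ^ r))
φ-twice r (suc m) = cong (digitValue (2 ^ r)) (bits-twice m)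

φ-twice+1 : ∀ r m → φ r (suc (m + m)) ≡ suc (2 ^ r * φ r m)
φ-twice+1 r m = cong (digitValue (2 ^ r)) (bits-twice+1 m)

2≤2^r : ∀ r .{{_ : NonZero r}} → 2 ≤ 2 ^ r
2≤2^r (suc r) = *-monoʳ-≤ 2 (m^n>0 2 r)

φ-step : ∀ r .{{_ : NonZero r}} n → φ r n < φ r (suc n)
φ-step r = <-rec (λ n → φ r n < φ r (suc n)) step
  where
  step : ∀ n → (∀ {m} → m < n → φ r m < φ r (suc m)) → φ r n < φ r (suc n)
  step n ih with halves n
  ... | twice m   = subst₂ _<_ (sym (φ-twice r m)) (sym (φ-twice+1 r m)) ≤-refl
  ... | twice+1 m = subst₂ _<_ (sym (φ-twice+1 r m))
    (sym (trans (cong (φ r ∘ suc) (sym (+-suc m m))) (φ-twice r (suc m)))) (begin-strict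
      suc (2 ^ r * φ r m)          <⟨ +-monoˡ-< (2 ^ r * φ r m) (2≤2^r r) ⟩
      2 ^ r + 2 ^ r * φ r m        ≡⟨ sym (*-suc (2 ^ r) (φ r m)) ⟩
      2 ^ r * suc (φ r m)          ≤⟨ *-monoʳ-≤ (2 ^ r) (ih (s≤s (m≤m+n m m))) ⟩
      2 ^ r * φ r (suc m)          ∎)
    where open ≤-Reasoning

φ-strictMono : ∀ r .{{_ : NonZero r}} m n → m < n → φ r m < φ r n
φ-strictMono r m (suc n) (s≤s m≤n) with m ≟ n
... | yes refl = φ-step r m
... | no  m≢n  = <-trans (φ-strictMono r m n (≤∧≢⇒< m≤n m≢n)) (φ-step r n)

n≤φ : ∀ r .{{_ : NonZero r}} n → n ≤ φ r n
n≤φ r zero    = z≤n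
n≤φ r (suc n) = ≤-trans (s≤s (n≤φ r n)) (φ-step r n)

-- Every φ r n is a sum of distinct powers of 2^r: the positions of the binary
-- digits 1 of n are the exponents.
onePositions : List Bool → List ℕ
onePositions []           = []
onePositions (true ∷ ds)  = 0 ∷ map suc (onePositions ds)
onePositions (false ∷ ds) = map suc (onePositions ds)

sum-powers-suc : ∀ k es → sum (map (k ^_) (map suc es)) ≡ k * sum (map (k ^_) es)
sum-powers-suc k []       = sym (*-zeroʳ k)
sum-powers-suc k (e ∷ es) = trans (cong (k * k ^ e +_) (sum-powers-suc k es))
  (sym (*-distribˡ-+ k (k ^ e) _))

onePositions-value : ∀ k ds → sum (map (k ^_) (onePositions ds)) ≡ digitValue k ds
onePositions-value k []           = refl
onePositions-value k (true ∷ ds)  =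
  cong suc (trans (sum-powers-suc k (onePositions ds)) (cong (k *_) (onePositions-value k ds)))
onePositions-value k (false ∷ ds) =
  trans (sum-powers-suc k (onePositions ds)) (cong (k *_) (onePositions-value k ds))

onePositions-unique : ∀ ds → Unique (onePositions ds)
onePositions-unique []           = []
onePositions-unique (true ∷ ds)  =
  All.map⁺ (All.tabulate (λ _ ())) ∷ Unique.map⁺ suc-injective (onePositions-unique ds)
onePositions-unique (false ∷ ds) = Unique.map⁺ suc-injective (onePositions-unique ds)

φ-sumDistinctPow : ∀ r n → SumDistinctPow (2 ^ r) (φ r n)
φ-sumDistinctPow r n =
  onePositions (bits n) , onePositions-unique (bits n) , onePositions-value (2 ^ r) (bits n)

-- Conversely every sum of distinct powers of 2^r is some φ r n: the exponent 0
-- occurs at most once (its count is the lowest digit), and lowering the other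
-- exponents by one leaves a strictly smaller sum of distinct powers.

zeroCount : List ℕ → ℕ
zeroCount []           = 0
zeroCount (zero ∷ es)  = suc (zeroCount es)
zeroCount (suc _ ∷ es) = zeroCount es

lowered : List ℕ → List ℕ
lowered []           = []
lowered (zero ∷ es)  = lowered es
lowered (suc e ∷ es) = e ∷ lowered es

sum-powers-split : ∀ k es → sum (map (k ^_) es) ≡ zeroCount es + k * sum (map (k ^_) (lowered es))
sum-powers-split k []           = sym (*-zeroʳ k)
sum-powers-split k (zero ∷ es)  = cong suc (sum-powers-split k es)
sum-powers-split k (suc e ∷ es) = begin
    k * k ^ e + sum (map (k ^_) es)
  ≡⟨ cong (k * k ^ e +_) (sum-powers-split k es) ⟩
    k * k ^ e + (zeroCount es + k * S)
  ≡⟨ x+[y+z]≡y+[x+z] (k * k ^ e) (zeroCount es) (k * S) ⟩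
    zeroCount es + (k * k ^ e + k * S)
  ≡⟨ cong (zeroCount es +_) (sym (*-distribˡ-+ k (k ^ e) S)) ⟩
    zeroCount es + k * (k ^ e + S)
  ∎
  where
  open ≡-Reasoning
  S = sum (map (k ^_) (lowered es))
  x+[y+z]≡y+[x+z] : ∀ x y z → x + (y + z) ≡ y + (x + z)
  x+[y+z]≡y+[x+z] x y z = trans (sym (+-assoc x y z)) (trans (cong (_+ z) (+-comm x y)) (+-assoc y x z))

zeroCount-absent : ∀ {es} → All.All (0 ≢_) es → zeroCount es ≡ 0
zeroCount-absent {[]}         _              = refl
zeroCount-absent {zero ∷ _}   (0≢0 All.∷ _)  = ⊥-elim (0≢0 refl)
zeroCount-absent {suc _ ∷ es} (_ All.∷ rest) = zeroCount-absent rest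

lowered-absent : ∀ e {es} → All.All (suc e ≢_) es → All.All (e ≢_) (lowered es)
lowered-absent e {[]}          _              = All.[]
lowered-absent e {zero ∷ _}    (_ All.∷ rest) = lowered-absent e rest
lowered-absent e {suc e' ∷ _}  (p All.∷ rest) = (λ e≡e' → p (cong suc e≡e')) All.∷ lowered-absent e rest

zeroCount≤1 : ∀ {es} → Unique es → zeroCount es ≤ 1
zeroCount≤1 {[]}         _              = z≤n
zeroCount≤1 {zero ∷ _}   (absent ∷ _)   = s≤s (≤-reflexive (zeroCount-absent absent))
zeroCount≤1 {suc _ ∷ _}  (_ ∷ distinct) = zeroCount≤1 distinct

lowered-unique : ∀ {es} → Unique es → Unique (lowered es)
lowered-unique {[]}          _                   = []
lowered-unique {zero ∷ _}    (_ ∷ distinct)      = lowered-unique distinct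
lowered-unique {suc e ∷ _}   (absent ∷ distinct) = lowered-absent e absent ∷ lowered-unique distinct

quotient< : ∀ {k} z y → 2 ≤ k → 0 < z + k * y → y < z + k * y
quotient< z zero    _   0<n = 0<n
quotient< {k} z (suc y) 2≤k _ = begin-strict
    suc y             <⟨ m<m+n (suc y) (s≤s z≤n) ⟩
    suc y + suc y     ≡⟨ cong (suc y +_) (sym (+-identityʳ (suc y))) ⟩
    2 * suc y         ≤⟨ *-monoˡ-≤ (suc y) 2≤k ⟩
    k * suc y         ≤⟨ m≤n+m (k * suc y) z ⟩
    z + k * suc y     ∎
  where open ≤-Reasoning

sumDistinctPow⇒φ : ∀ r .{{_ : NonZero r}} x → SumDistinctPow (2 ^ r) x → ∃ λ n → φ r n ≡ x
sumDistinctPow⇒φ r = <-rec (λ x → SumDistinctPow (2 ^ r) x → ∃ λ n → φ r n ≡ x) step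
  where
  k = 2 ^ r
  step : ∀ x → (∀ {y} → y < x → SumDistinctPow k y → ∃ λ n → φ r n ≡ y) →
         SumDistinctPow k x → ∃ λ n → φ r n ≡ x
  step zero    _  _                         = 0 , refl
  step (suc x) ih (es , distinct , es-sum) = withLowestDigit (zeroCount≤1 distinct) x≡
    where
    x' = sum (map (k ^_) (lowered es))
    x≡ : suc x ≡ zeroCount es + k * x'
    x≡ = trans (sym es-sum) (sum-powers-split k es)
    lowerPart : ∃ λ n → φ r n ≡ x'
    lowerPart = ih x'<1+x (lowered es , lowered-unique distinct , refl)
      where
      x'<1+x : x' < suc x
      x'<1+x = subst (x' <_) (sym x≡) (quotient< (zeroCount es) x' (2≤2^r r) (subst (0 <_) x≡ (s≤s z≤n)))
    n' = proj₁ lowerPart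
    withLowestDigit : ∀ {z} → z ≤ 1 → suc x ≡ z + k * x' → ∃ λ n → φ r n ≡ suc x
    withLowestDigit z≤n       e = n' + n' ,
      trans (φ-twice r n') (trans (cong (k *_) (proj₂ lowerPart)) (sym e))
    withLowestDigit (s≤s z≤n) e = suc (n' + n') ,
      trans (φ-twice+1 r n') (trans (cong (λ y → suc (k * y)) (proj₂ lowerPart)) (sym e))

-- The characteristic series M_r of {φ r n : n ∈ ℕ}; membership is decidable
-- because n ≤ φ r n.
inImage? : ∀ r .{{_ : NonZero r}} x → Dec (∃ λ n → φ r n ≡ x)
inImage? r x = map′ (λ (n , _ , e) → n , e) (λ (n , e) → n , s≤s (subst (n ≤_) e (n≤φ r n)) , e)
                    (anyUpTo? (λ n → φ r n ≟ x) (suc x))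

M : ∀ r .{{_ : NonZero r}} → Series
M r x = does (inImage? r x)

M-φ : ∀ r .{{_ : NonZero r}} n → M r (φ r n) ≡ true
M-φ r n = dec-true (inImage? r (φ r n)) (n , refl)

M-sound : ∀ r .{{_ : NonZero r}} x → M r x ≡ true → ∃ λ n → φ r n ≡ x
M-sound r x = witness (inImage? r x)
  where
  witness : ∀ {A : Set} (a? : Dec A) → does a? ≡ true → A
  witness (yes a) _ = a
  witness (no _)  ()

-- For r ≥ 1 the values φ r (2a) = 2^r φ r a are even and φ r (2b+1) = 2^r φ r b + 1 odd.
twice≢twice+1 : ∀ a b → a + a ≢ suc (b + b)
twice≢twice+1 a b e with () ← trans (sym (isEven-twice a)) (trans (cong isEven e) (isEven-twice+1 b))

φ-twice≢twice+1 : ∀ r .{{_ : NonZero r}} a b → φ r (a + a) ≢ φ r (suc (b + b))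
φ-twice≢twice+1 (suc r) a b e = twice≢twice+1 (2 ^ r * φ (suc r) a) (2 ^ r * φ (suc r) b) (begin
    2 ^ r * φ (suc r) a + 2 ^ r * φ (suc r) a
  ≡⟨ sym (2^suc-* r (φ (suc r) a)) ⟩
    2 ^ suc r * φ (suc r) a
  ≡⟨ sym (φ-twice (suc r) a) ⟩
    φ (suc r) (a + a)
  ≡⟨ e ⟩
    φ (suc r) (suc (b + b))
  ≡⟨ φ-twice+1 (suc r) b ⟩
    suc (2 ^ suc r * φ (suc r) b)
  ≡⟨ cong suc (2^suc-* r (φ (suc r) b)) ⟩
    suc (2 ^ r * φ (suc r) b + 2 ^ r * φ (suc r) b)
  ∎)
  where open ≡-Reasoning

-- M_r = (1 + X) M_r(X^(2^r)): the image of φ r splits into the even-indexed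
-- values 2^r φ r m and the odd-indexed values 2^r φ r m + 1.
M-equation : ∀ r .{{_ : NonZero r}} → M r ≗ mul (add one Xs) (dilateⁿ r (M r))
M-equation r x = trans (onTwoCosets x (inImage? r x)) (sym (mul-1+X T x))
  where
  T : Series
  T = dilateⁿ r (M r)
  T-φ : ∀ m → T (φ r (m + m)) ≡ true
  T-φ m = trans (cong T (φ-twice r m)) (trans (dilateⁿ-at r (M r) (φ r m)) (M-φ r m))
  T-sound : ∀ y → T y ≡ true → ∃ λ m → φ r (m + m) ≡ y
  T-sound y Ty with dilateⁿ-support r (M r) y Ty
  ... | z , y≡2^rz , Mz with M-sound r z Mz
  ...   | m , refl = m , trans (φ-twice r m) (sym y≡2^rz)
  T-false : ∀ y → (∀ m → φ r (m + m) ≢ y) → T y ≡ false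
  T-false y ∉ = ¬-not (λ Ty → ∉ (proj₁ (T-sound y Ty)) (proj₂ (T-sound y Ty)))
  shiftT-false : ∀ y → (∀ m → φ r (suc (m + m)) ≢ y) → shift T y ≡ false
  shiftT-false zero    _ = refl
  shiftT-false (suc y) ∉ = T-false y
    (λ m e → ∉ m (trans (φ-twice+1 r m) (cong suc (trans (sym (φ-twice r m)) e))))
  onTwoCosets : ∀ x → Dec (∃ λ n → φ r n ≡ x) → M r x ≡ (T x xor shift T x)
  onTwoCosets x (no ∉) = trans (dec-false (inImage? r x) ∉)
    (sym (cong₂ _xor_ (T-false x (λ m e → ∉ (m + m , e))) (shiftT-false x (λ m e → ∉ (suc (m + m) , e)))))
  onTwoCosets _ (yes (n , refl)) = trans (M-φ r n) (sym (coset (halves n)))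
    where
    coset : ∀ {n} → Halves n → (T (φ r n) xor shift T (φ r n)) ≡ true
    coset (twice m)   = cong₂ _xor_ (T-φ m) (shiftT-false _ (λ m' e → φ-twice≢twice+1 r m m' (sym e)))
    coset (twice+1 m) = cong₂ _xor_ (T-false _ (λ m' e → φ-twice≢twice+1 r m' m e))
      (trans (cong (shift T) (trans (φ-twice+1 r m) (cong suc (sym (φ-twice r m))))) (T-φ m))

-- Uniqueness of the solution of the fixed-point equation satisfied by M_r B_r(X M_r)
-- below (r ≥ 1): coefficient n + 1 of the right-hand side only involves
-- coefficients of F up to n.
fixedPoint-one : ∀ r .{{_ : NonZero r}} F → F 0 ≡ true →
  F ≗ add (mul Xs (dilate F)) (mul (add one Xs) (dilateⁿ r F)) → F ≗ one
fixedPoint-one r F F₀ equation n = agreeUpTo n n ≤-refl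
  where
  agreeUpTo : ∀ n → AgreeUpTo n F one
  agreeUpTo zero    zero z≤n = F₀
  agreeUpTo (suc n) i i≤1+n with i ≟ suc n
  ... | no  i≢1+n = agreeUpTo n i (s≤s⁻¹ (≤∧≢⇒< i≤1+n i≢1+n))
  ... | yes refl  = begin
      F (suc n)
    ≡⟨ equation (suc n) ⟩
      mul Xs (dilate F) (suc n) xor mul (add one Xs) (dilateⁿ r F) (suc n)
    ≡⟨ cong₂ _xor_ (mul-X (dilate F) (suc n)) (mul-1+X (dilateⁿ r F) (suc n)) ⟩
      dilate F n xor (dilateⁿ r F (suc n) xor dilateⁿ r F n)
    ≡⟨ cong₂ (λ a b → a xor (b xor dilateⁿ r F n))
         (trans (dilate-agree n ih n (n≤1+n n)) (dilate-one n))
         (trans (dilateⁿ-agree-suc r n ih) (dilateⁿ-one r (suc n))) ⟩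
      one n xor dilateⁿ r F n
    ≡⟨ cong (one n xor_) (trans (dilateⁿ-agree r n ih n ≤-refl) (dilateⁿ-one r n)) ⟩
      one n xor one n
    ≡⟨ xor-same (one n) ⟩
      false
    ∎
    where
    open ≡-Reasoning
    ih = agreeUpTo n

cancel-outer : ∀ o a t → o xor (a xor (t xor o)) ≡ a xor t
cancel-outer false a t = cong (a xor_) (xor-identityʳ t)
cancel-outer true  false false = refl
cancel-outer true  false true  = refl
cancel-outer true  true  false = refl
cancel-outer true  true  true  = refl

inverseSeries : ∀ r .{{_ : NonZero r}} → Series
inverseSeries r = shift (M r)

D≗XB : ∀ r → D r ≗ mul Xs (B r)
D≗XB r zero    = refl
D≗XB r (suc n) = sym (mul-X (B r) (suc n))

D-inverseSeries : ∀ r .{{_ : NonZero r}} → comp (D r) (inverseSeries r) ≗ Xs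
D-inverseSeries r = begin
    comp (D r) Y
  ≈⟨ comp-congˡ Y (D≗XB r) ⟩
    comp (mul Xs (B r)) Y
  ≈⟨ comp-mul Xs (B r) Y refl ⟩
    mul (comp Xs Y) E
  ≈⟨ mul-congˡ E (comp-X Y refl) ⟩
    mul Y E
  ≈⟨ mul-congˡ E (mul-X (M r)) ⟨
    mul (mul Xs (M r)) E
  ≈⟨ mul-assoc Xs (M r) E ⟩
    mul Xs F
  ≈⟨ mul-congʳ Xs (fixedPoint-one r F refl F-equation) ⟩
    mul Xs one
  ≈⟨ mul-identityʳ Xs ⟩
    Xs
  ∎
  where
  open ≗-Reasoning
  Y E F : Series
  Y = inverseSeries r
  E = comp (B r) Y
  F = mul (M r) E
  E-equation : E ≗ add (mul Y (dilate E)) (dilateⁿ r E)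
  E-equation = begin
      E
    ≈⟨ comp-congˡ Y (B-equation r) ⟩
      comp (add one (add (shift (dilate (B r))) (dilateⁿ r (B⁺ r)))) Y
    ≈⟨ comp-add one _ Y ⟩
      add (comp one Y) (comp (add (shift (dilate (B r))) (dilateⁿ r (B⁺ r))) Y)
    ≈⟨ (λ n → cong₂ _xor_ (comp-one Y n) (comp-add _ _ Y n)) ⟩
      add one (add (comp (shift (dilate (B r))) Y) (comp (dilateⁿ r (B⁺ r)) Y))
    ≈⟨ (λ n → cong₂ (λ a t → one n xor (a xor t)) (evenPart n) (shiftedPart n)) ⟩
      add one (add (mul Y (dilate E)) (add (dilateⁿ r E) one))
    ≈⟨ (λ n → cancel-outer (one n) (mul Y (dilate E) n) (dilateⁿ r E n)) ⟩
      add (mul Y (dilate E)) (dilateⁿ r E)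
    ∎
    where
    evenPart : comp (shift (dilate (B r))) Y ≗ mul Y (dilate E)
    evenPart = begin
        comp (shift (dilate (B r))) Y
      ≈⟨ comp-congˡ Y (mul-X (dilate (B r))) ⟨
        comp (mul Xs (dilate (B r))) Y
      ≈⟨ comp-mul Xs (dilate (B r)) Y refl ⟩
        mul (comp Xs Y) (comp (dilate (B r)) Y)
      ≈⟨ mul-cong (comp-X Y refl) (comp-dilate (B r) Y refl) ⟩
        mul Y (dilate E)
      ∎
    shiftedPart : comp (dilateⁿ r (B⁺ r)) Y ≗ add (dilateⁿ r E) one
    shiftedPart = begin
        comp (dilateⁿ r (B⁺ r)) Y
      ≈⟨ comp-dilateⁿ r (B⁺ r) Y refl ⟩
        dilateⁿ r (comp (add (B r) one) Y)
      ≈⟨ dilateⁿ-cong r (λ n → trans (comp-add (B r) one Y n) (cong (E n xor_) (comp-one Y n))) ⟩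
        dilateⁿ r (add E one)
      ≈⟨ dilateⁿ-add r E one ⟩
        add (dilateⁿ r E) (dilateⁿ r one)
      ≈⟨ add-congʳ (dilateⁿ r E) (dilateⁿ-one r) ⟩
        add (dilateⁿ r E) one
      ∎
  -- Multiplying by M_r = (1 + X) M_r(X^(2^r)) turns this into the fixed-point equation.
  F-equation : F ≗ add (mul Xs (dilate F)) (mul (add one Xs) (dilateⁿ r F))
  F-equation = begin
      mul (M r) E
    ≈⟨ mul-congʳ (M r) E-equation ⟩
      mul (M r) (add (mul Y (dilate E)) (dilateⁿ r E))
    ≈⟨ mul-distribˡ (M r) (mul Y (dilate E)) (dilateⁿ r E) ⟩
      add (mul (M r) (mul Y (dilate E))) (mul (M r) (dilateⁿ r E))
    ≈⟨ (λ n → cong₂ _xor_ (firstTerm n) (secondTerm n)) ⟩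
      add (mul Xs (dilate F)) (mul (add one Xs) (dilateⁿ r F))
    ∎
    where
    firstTerm : mul (M r) (mul Y (dilate E)) ≗ mul Xs (dilate F)
    firstTerm = begin
        mul (M r) (mul Y (dilate E))
      ≈⟨ mul-congʳ (M r) (mul-congˡ (dilate E) (mul-X (M r))) ⟨
        mul (M r) (mul (mul Xs (M r)) (dilate E))
      ≈⟨ mul-congʳ (M r) (mul-assoc Xs (M r) (dilate E)) ⟩
        mul (M r) (mul Xs (mul (M r) (dilate E)))
      ≈⟨ mul-leftComm (M r) Xs (mul (M r) (dilate E)) ⟩
        mul Xs (mul (M r) (mul (M r) (dilate E)))
      ≈⟨ mul-congʳ Xs (mul-assoc (M r) (M r) (dilate E)) ⟨
        mul Xs (mul (mul (M r) (M r)) (dilate E))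
      ≈⟨ mul-congʳ Xs (mul-congˡ (dilate E) (frobenius (M r))) ⟩
        mul Xs (mul (dilate (M r)) (dilate E))
      ≈⟨ mul-congʳ Xs (dilate-mul (M r) E) ⟩
        mul Xs (dilate F)
      ∎
    secondTerm : mul (M r) (dilateⁿ r E) ≗ mul (add one Xs) (dilateⁿ r F)
    secondTerm = begin
        mul (M r) (dilateⁿ r E)
      ≈⟨ mul-congˡ (dilateⁿ r E) (M-equation r) ⟩
        mul (mul (add one Xs) (dilateⁿ r (M r))) (dilateⁿ r E)
      ≈⟨ mul-assoc (add one Xs) (dilateⁿ r (M r)) (dilateⁿ r E) ⟩
        mul (add one Xs) (mul (dilateⁿ r (M r)) (dilateⁿ r E))
      ≈⟨ mul-congʳ (add one Xs) (dilateⁿ-mul r (M r) E) ⟩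
        mul (add one Xs) (dilateⁿ r F)
      ∎

pow-agree : ∀ {Q Y} n → AgreeUpTo n Q Y → ∀ k → pow Q k n ≡ pow Y k n
pow-agree n agree zero    = refl
pow-agree n agree (suc k) = sum-cong n (λ i i≤n → cong₂ _∧_ (agree i i≤n)
  (pow-agree (n ∸ i) (λ j j≤n∸i → agree j (≤-trans j≤n∸i (m∸n≤m n i))) k))

pow-agree-below : ∀ {Q Y} → Q 0 ≡ false → Y 0 ≡ false → ∀ n → (∀ {i} → i < n → Q i ≡ Y i) →
  ∀ k → pow Q (2 + k) n ≡ pow Y (2 + k) n
pow-agree-below {Q} {Y} Q₀ Y₀ zero _ k =
  trans (pow-vanish Q Q₀ (2 + k) 0 (s≤s z≤n)) (sym (pow-vanish Y Y₀ (2 + k) 0 (s≤s z≤n)))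
pow-agree-below {Q} {Y} Q₀ Y₀ (suc n) below k = sum-cong (suc n) term
  where
  term : ∀ i → i ≤ suc n → (Q i ∧ pow Q (suc k) (suc n ∸ i)) ≡ (Y i ∧ pow Y (suc k) (suc n ∸ i))
  term zero    _         = trans (cong (_∧ pow Q (suc k) (suc n)) Q₀) (sym (cong (_∧ pow Y (suc k) (suc n)) Y₀))
  term (suc i) (s≤s i≤n) with m≤n⇒m<n∨m≡n i≤n
  ... | inj₁ i<n  = cong₂ _∧_ (below (s≤s i<n))
         (pow-agree (n ∸ i) (λ j j≤n∸i → below (s≤s (≤-trans j≤n∸i (m∸n≤m n i)))) (suc k))
  ... | inj₂ refl = trans (lastTerm Q Q₀) (sym (lastTerm Y Y₀))
    where
    i∸i<1+k : i ∸ i < suc k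
    i∸i<1+k = subst (_< suc k) (sym (n∸n≡0 i)) (s≤s z≤n)
    lastTerm : ∀ Z → Z 0 ≡ false → (Z (suc i) ∧ pow Z (suc k) (i ∸ i)) ≡ false
    lastTerm Z Z₀ = trans (cong (Z (suc i) ∧_) (pow-vanish Z Z₀ (suc k) (i ∸ i) i∸i<1+k)) (∧-zeroʳ _)

xor≡false⇒≡ : ∀ {a b} → (a xor b) ≡ false → a ≡ b
xor≡false⇒≡ {false} {false} _ = refl
xor≡false⇒≡ {true}  {true}  _ = refl

-- If U(Q) = U(Y) = X with U₁ = 1 and Q, Y of zero constant term, then Q = Y:
-- in U(Q)_n + U(Y)_n only the term U₁ (Q_n + Y_n) survives, by induction on n.
rightInverse-unique : ∀ U Q Y → U 1 ≡ true → Q 0 ≡ false → Y 0 ≡ false →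
  comp U Q ≗ Xs → comp U Y ≗ Xs → Q ≗ Y
rightInverse-unique U Q Y U₁ Q₀ Y₀ UQ UY = <-rec (λ n → Q n ≡ Y n) step
  where
  step : ∀ n → (∀ {i} → i < n → Q i ≡ Y i) → Q n ≡ Y n
  step zero    _     = trans Q₀ (sym Y₀)
  step (suc n) below = xor≡false⇒≡ (begin
      Q (suc n) xor Y (suc n)
    ≡⟨ sym termDifference₁ ⟩
      termDifference 1
    ≡⟨ sym (sum-single termDifference (suc n) 1 (s≤s z≤n) otherTerms) ⟩
      sumTo termDifference (suc n)
    ≡⟨ sum-xor _ _ (suc n) ⟩
      comp U Q (suc n) xor comp U Y (suc n)
    ≡⟨ cong₂ _xor_ (UQ (suc n)) (UY (suc n)) ⟩
      Xs (suc n) xor Xs (suc n)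
    ≡⟨ xor-same (Xs (suc n)) ⟩
      false
    ∎)
    where
    open ≡-Reasoning
    termDifference : ℕ → Bool
    termDifference k = (U k ∧ pow Q k (suc n)) xor (U k ∧ pow Y k (suc n))
    termDifference₁ : termDifference 1 ≡ (Q (suc n) xor Y (suc n))
    termDifference₁ = trans
      (cong₂ (λ a b → (U 1 ∧ a) xor (U 1 ∧ b)) (mul-identityʳ Q (suc n)) (mul-identityʳ Y (suc n)))
      (cong (λ u → (u ∧ Q (suc n)) xor (u ∧ Y (suc n))) U₁)
    otherTerms : ∀ k → k ≤ suc n → k ≢ 1 → termDifference k ≡ false
    otherTerms zero          _ _   = xor-same (U 0 ∧ one (suc n))
    otherTerms (suc zero)    _ 1≢1 = ⊥-elim (1≢1 refl)
    otherTerms (suc (suc k)) _ _   = trans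
      (cong (λ c → (U (2 + k) ∧ pow Q (2 + k) (suc n)) xor (U (2 + k) ∧ c))
            (sym (pow-agree-below Q₀ Y₀ (suc n) below k)))
      (xor-same (U (2 + k) ∧ pow Q (2 + k) (suc n)))

StrictlyIncreasing : (ℕ → ℕ) → Set
StrictlyIncreasing f = ∀ m n → m < n → f m < f n

strictlyIncreasing⇒monotone : ∀ {f} → StrictlyIncreasing f → ∀ {m n} → m ≤ n → f m ≤ f n
strictlyIncreasing⇒monotone f↑ {m} {n} m≤n with m≤n⇒m<n∨m≡n m≤n
... | inj₁ m<n  = <⇒≤ (f↑ m n m<n)
... | inj₂ refl = ≤-refl

-- If f, g are strictly increasing, agree below n, and g's values are f-values,
-- then f n ≤ g n: writing g n = f m, m < n would give g n = g m.
enumeration-≤ : ∀ f g → StrictlyIncreasing f → StrictlyIncreasing g →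
  (∀ x → (∃ λ k → g k ≡ x) → ∃ λ k → f k ≡ x) →
  ∀ n → (∀ {k} → k < n → f k ≡ g k) → f n ≤ g n
enumeration-≤ f g f↑ g↑ g⊆f n below with g⊆f (g n) (n , refl)
... | m , fm≡gn with m <? n
...   | yes m<n = ⊥-elim (<-irrefl (trans (sym (below m<n)) fm≡gn) (g↑ m n m<n))
...   | no  m≮n = subst (f n ≤_) fm≡gn (strictlyIncreasing⇒monotone f↑ (≮⇒≥ m≮n))

enumeration-unique : ∀ f g → StrictlyIncreasing f → StrictlyIncreasing g →
  (∀ x → (∃ λ k → f k ≡ x) → ∃ λ k → g k ≡ x) →
  (∀ x → (∃ λ k → g k ≡ x) → ∃ λ k → f k ≡ x) → f ≗ g
enumeration-unique f g f↑ g↑ f⊆g g⊆f = <-rec (λ n → f n ≡ g n) λ n below →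
  ≤-antisym (enumeration-≤ f g f↑ g↑ g⊆f n below) (enumeration-≤ g f g↑ f↑ f⊆g n (sym ∘ below))

φ-enumerates : ∀ r .{{_ : NonZero r}} mseq → IsIncEnum mseq (SumDistinctPow (2 ^ r)) → φ r ≗ mseq
φ-enumerates r mseq (mseq↑ , mseq-enumerates) = enumeration-unique (φ r) mseq (φ-strictMono r) mseq↑
  (λ x (k , φk≡x) → proj₁ (mseq-enumerates x)
                       (subst (SumDistinctPow (2 ^ r)) φk≡x (φ-sumDistinctPow r k)))
  (λ x mseq-hits-x → sumDistinctPow⇒φ r x (proj₂ (mseq-enumerates x) mseq-hits-x))

inverseSeries-support : ∀ r .{{_ : NonZero r}} → IsIncEnum (suc ∘ φ r) (λ m → inverseSeries r m ≡ true)
inverseSeries-support r = (λ m n m<n → s≤s (φ-strictMono r m n m<n)) , enumerates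
  where
  enumerates : ∀ m → (inverseSeries r m ≡ true → ∃ λ n → suc (φ r n) ≡ m) ×
                     ((∃ λ n → suc (φ r n) ≡ m) → inverseSeries r m ≡ true)
  enumerates zero    = (λ ()) , (λ ())
  enumerates (suc x) = (λ Mx → proj₁ (M-sound r x Mx) , cong suc (proj₂ (M-sound r x Mx)))
                     , (λ { (n , refl) → M-φ r n })

-- Main theorem: by uniqueness of right inverses Q = X M_r.  (The hypothesis
-- r ≥ 2 is only used as r ≥ 1.)
mainTheorem18 : (r : ℕ) → 2 ≤ r → (Q : Series) → IsCompInverse (D r) Q →
    Σ (ℕ → ℕ) (λ u → IsIncEnum u (λ m → Q m ≡ true) ×
      ((mseq : ℕ → ℕ) → IsIncEnum mseq (SumDistinctPow (2 ^ r)) →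
        (n : ℕ) → u n ≡ suc (mseq n)))
mainTheorem18 r 2≤r Q (Q₀ , D∘Q≗X , _) =
  suc ∘ φ r , support , λ mseq mseq-enumerates n → cong suc (φ-enumerates r mseq mseq-enumerates n)
  where
  instance
    r-nonZero : NonZero r
    r-nonZero = >-nonZero (≤-trans (s≤s z≤n) 2≤r)
  Q≗XM : Q ≗ inverseSeries r
  Q≗XM = rightInverse-unique (D r) Q (inverseSeries r) refl Q₀ refl D∘Q≗X (D-inverseSeries r)
  support : IsIncEnum (suc ∘ φ r) (λ m → Q m ≡ true)
  support = proj₁ (inverseSeries-support r) , λ m →
    (λ Qm → proj₁ (proj₂ (inverseSeries-support r) m) (trans (sym (Q≗XM m)) Qm)) ,
    (λ hit → trans (Q≗XM m) (proj₂ (proj₂ (inverseSeries-support r) m) hit))
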